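{- Fix a bipartite degree sequence $k=((r_1,\dots,r_n),(c_1,\dots,c_{n'}))$ and let $\Omega_k$ be the set of bipartite graphs on primary nodes $p_1,\dots,p_n$ and secondary nodes $s_1,\dots,s_{n'}$ with $\deg p_i=r_i$ and $\deg s_j=c_j$ (equivalently, binary $n\times n'$ matrices with row sums $r$ and column sums $c$). Let $P^S$ and $P^C$ be the transition matrices on $\Omega_k$ of the switch chain and the Curveball chain. Let $G\sim H$ if $G$ and $H$ are isomorphic as bipartite graphs, i.e. there exist bijections $\sigma_1$ of the primary nodes and $\sigma_2$ of the secondary nodes such that $\{p,s\}$ is an edge of $G$ iff $\{\sigma_1(p),\sigma_2(s)\}$ is an edge of $H$. Then both $P=P^S$ and $P=P^C$ satisfy $P_{G[H]}=P_{G'[H]}$ for all $H\in\Omega_k$ and all $G\sim G'$, where $P_{G[H]}:=\sum_{K\in[H]}P_{GK}$.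
   Context: Switch chain: from the current matrix $A\in\Omega_k$, choose two non-zero entries (edges) uniformly at random; if the $2\times2$ submatrix formed by their rows and columns is $\begin{pmatrix}1&0\\0&1\end{pmatrix}$ or $\begin{pmatrix}0&1\\1&0\end{pmatrix}$, replace it by the other one (a switch), otherwise stay. Curveball chain: choose a pair of rows $i\neq j$ uniformly at random (probability $\binom{n}{2}^{ -1}$); let $S_i$ be the set of columns where row $i$ is $1$ and row $j$ is $0$, $S_j$ the set where row $i$ is $0$ and row $j$ is $1$, $s_i=|S_i|$, $s_j=|S_j|$; choose uniformly at random (probability $\binom{s_i+s_j}{s_i}^{ -1}$) an $s_i$-subset $T$ of $S_i\cup S_j$ and set row $i$ to $1$ exactly on $T$ and row $j$ to $1$ exactly on $(S_i\cup S_j)\setminus T$ within these columns, leaving all other columns unchanged (a trade). -}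

module Defs where

open import Data.Bool using (Bool; true; false; if_then_else_; _∧_; _xor_; not)
open import Data.Nat using (ℕ; zero; suc; _≡ᵇ_; _<ᵇ_)
open import Data.Nat.Combinatorics using (_C_)
open import Data.Fin using (Fin; toℕ)
open import Data.Fin.Permutation using (Permutation′; _⟨$⟩ʳ_)
open import Data.Vec using (Vec; []; _∷_; lookup; _[_]≔_; allFin; toList)
open import Data.List using (List; []; _∷_; map; _++_; concatMap; foldr)
open import Data.Product using (Σ; _×_; _,_; ∃₂)
open import Data.Integer using (+_)
open import Data.Rational using (ℚ; _/_; 0ℚ; 1ℚ; _+_; _*_)
open import Relation.Nullary.Decidable using (⌊_⌋)
open import Relation.Binary.PropositionalEquality using (_≡_)
import Data.Vec.Properties as VP
import Data.Bool.Properties as BP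

-- Binary n × m matrices = bipartite graphs on primary nodes Fin n and
-- secondary nodes Fin m (entry i j = true iff {p_i , s_j} is an edge).

Mat : ℕ → ℕ → Set
Mat n m = Vec (Vec Bool m) n

entry : ∀ {n m} → Mat n m → Fin n → Fin m → Bool
entry A i j = lookup (lookup A i) j

setEntry : ∀ {n m} → Mat n m → Fin n → Fin m → Bool → Mat n m
setEntry A i j b = A [ i ]≔ (lookup A i [ j ]≔ b)

eqMat : ∀ {n m} → Mat n m → Mat n m → Bool
eqMat A B = ⌊ VP.≡-dec (VP.≡-dec BP._≟_) A B ⌋

countB : ∀ {a} {A : Set a} → (A → Bool) → List A → ℕ
countB p [] = 0
countB p (x ∷ xs) = if p x then suc (countB p xs) else countB p xs

bval : Bool → ℕ
bval true = 1
bval false = 0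

allVec : (m : ℕ) → List (Vec Bool m)
allVec zero = [] ∷ []
allVec (suc m) = map (true ∷_) (allVec m) ++ map (false ∷_) (allVec m)

pairsOf : ∀ {a} {A : Set a} → List A → List (A × A)
pairsOf [] = []
pairsOf (x ∷ xs) = map (x ,_) xs ++ pairsOf xs

sumℚ : List ℚ → ℚ
sumℚ = foldr _+_ 0ℚ

-- a / d as a rational (d = 0 never used meaningfully; returns 0)
frac : ℕ → ℕ → ℚ
frac a zero = 0ℚ
frac a (suc d) = (+ a) / suc d

indicator : Bool → ℚ
indicator true = 1ℚ
indicator false = 0ℚ

rowSum : ∀ {n m} → Mat n m → Fin n → ℕ
rowSum A i = countB (λ b → b) (toList (lookup A i))

colSum : ∀ {n m} → Mat n m → Fin m → ℕ
colSum A j = countB (λ i → entry A i j) (toList (allFin _))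

InΩ : ∀ {n m} → Vec ℕ n → Vec ℕ m → Mat n m → Set
InΩ r c A = (∀ i → rowSum A i ≡ lookup r i) × (∀ j → colSum A j ≡ lookup c j)

_∼_ : ∀ {n m} → Mat n m → Mat n m → Set
_∼_ {n} {m} G H = Σ (Permutation′ n) λ σ₁ → Σ (Permutation′ m) λ σ₂ →
  ∀ i j → entry G i j ≡ entry H (σ₁ ⟨$⟩ʳ i) (σ₂ ⟨$⟩ʳ j)

Edge : ℕ → ℕ → Set
Edge n m = Fin n × Fin m

edges : ∀ {n m} → Mat n m → List (Edge n m)
edges {n} {m} A =
  concatMap (λ i → concatMap (λ j → if entry A i j then (i , j) ∷ [] else [])
                              (toList (allFin m)))
            (toList (allFin n))

switchStep : ∀ {n m} → Mat n m → Edge n m → Edge n m → Mat n m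
switchStep A (i , j) (i' , j') =
  if not (entry A i j') ∧ not (entry A i' j)
  then setEntry (setEntry (setEntry (setEntry A i j false) i' j' false) i j' true) i' j true
  else A

-- transition probability P^S_{GK}: the unordered pair of distinct edges is
-- chosen uniformly among the (|E| choose 2) pairs.
PS : ∀ {n m} → Mat n m → Mat n m → ℚ
PS G K with edges G
... | es with pairsOf es | Data.List.length es C 2
...   | ps | zero = indicator (eqMat G K)
...   | ps | suc d = frac (countB (λ { (e , f) → eqMat (switchStep G e f) K }) ps) (suc d)
  where import Data.List

inSym : ∀ {n m} → Mat n m → Fin n → Fin n → Fin m → Bool
inSym A i j l = entry A i l xor entry A j l

sDiff : ∀ {n m} → Mat n m → Fin n → Fin n → ℕ
sDiff {m = m} A i j = countB (λ l → entry A i l ∧ not (entry A j l)) (toList (allFin m))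

admissible : ∀ {n m} → Mat n m → Fin n → Fin n → Vec Bool m → Bool
admissible {m = m} A i j T =
  (countB (λ l → lookup T l ∧ not (inSym A i j l)) (toList (allFin m)) ≡ᵇ 0)
  ∧ (countB (λ l → lookup T l) (toList (allFin m)) ≡ᵇ sDiff A i j)

trade : ∀ {n m} → Mat n m → Fin n → Fin n → Vec Bool m → Mat n m
trade {m = m} A i j T =
  (A [ i ]≔ Data.Vec.tabulate (λ l → if inSym A i j l then lookup T l else entry A i l))
     [ j ]≔ Data.Vec.tabulate (λ l → if inSym A i j l then not (lookup T l) else entry A j l)
  where import Data.Vec

tradeProb : ∀ {n m} → Mat n m → Fin n → Fin n → Mat n m → ℚ
tradeProb {m = m} G i j K =
  frac (countB (λ T → admissible G i j T ∧ eqMat (trade G i j T) K) (allVec m))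
       ((sDiff G i j Data.Nat.+ sDiff G j i) C sDiff G i j)
  where import Data.Nat

-- transition probability P^C_{GK}: unordered row pair uniform among (n choose 2)
PC : ∀ {n m} → Mat n m → Mat n m → ℚ
PC {n} G K with n C 2
... | zero = indicator (eqMat G K)
... | suc d = frac 1 (suc d) *
              sumℚ (map (λ { (i , j) → tradeProb G i j K }) (pairsOf (toList (allFin n))))

module Submission where

-- If G ∼ G′ then G = relabel σ₁ σ₂ G′ for permutations σ₁ of the
-- primary and σ₂ of the secondary nodes.  Both chains are built only from
-- the structure of the graph, so they are relabelling-invariant:
-- P (relabel σ A) (relabel σ K) = P A K  (PS-relabel, PC-relabel).
-- Moreover relabel σ permutes the class [H] ∩ Ω_k, since σ preserves the
-- degree sequence (σ maps G′ ∈ Ω_k to G ∈ Ω_k).  Reindexing the sum over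
-- [H] along relabel σ then gives Σ_K P_{G K} = Σ_K P_{G′ K}.

open import Defs
open import Algebra.Bundles using (CommutativeMonoid)
open import Algebra.Structures using (IsCommutativeMonoid)
open import Data.Bool using (Bool; true; false; if_then_else_; _∧_; _xor_; not)
open import Data.Nat using (ℕ; zero; suc; _+_; _∸_; _≡ᵇ_)
open import Data.Nat.Combinatorics using (_C_; nCk≡nC[n∸k])
import Data.Nat.Properties as ℕP
open import Data.Fin using (Fin; _≟_)
open import Data.Fin.Permutation using (Permutation′; _⟨$⟩ʳ_; _⟨$⟩ˡ_; inverseˡ; inverseʳ; flip; _∘ₚ_)
open import Data.Vec as Vec using (Vec; []; _∷_; lookup; allFin; toList; _[_]≔_)
import Data.Vec.Properties as VecP
import Data.Bool.Properties as BoolP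
open import Data.List using (List; []; _∷_; map; _++_; concatMap; foldr; length)
import Data.List.Properties as ListP
open import Data.List.Membership.Propositional using (_∈_; find; lose)
open import Data.List.Membership.Propositional.Properties
  using (∈-map⁺; ∈-map⁻; ∈-++⁺ˡ; ∈-++⁺ʳ; ∈-allFin; ∈-concatMap⁺; ∈-concatMap⁻)
open import Data.List.Membership.Propositional.Properties.WithK using (unique∧set⇒bag)
open import Data.List.Relation.Binary.BagAndSetEquality using (∼bag⇒↭)
open import Data.List.Relation.Binary.Permutation.Propositional as Perm using (_↭_; ↭⇒↭ₛ)
import Data.List.Relation.Binary.Permutation.Propositional.Properties as PermP
import Data.List.Relation.Binary.Permutation.Setoid.Properties as PermSetoidP
import Data.List.Relation.Unary.All as All
open import Data.List.Relation.Unary.Any using (here)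
open import Data.List.Relation.Unary.AllPairs using (_∷_; [])
open import Data.List.Relation.Unary.Unique.Propositional using (Unique)
import Data.List.Relation.Unary.Unique.Propositional.Properties as UniqueP
open import Data.Rational using (ℚ; _*_)
import Data.Rational.Properties as ℚP
open import Data.Product using (_×_; _,_; proj₁; proj₂)
open import Data.Empty using (⊥)
open import Function.Bundles using (_⇔_; mk⇔; Equivalence)
open import Level using (0ℓ)
open import Relation.Nullary using (Dec; does; yes; no; ¬_)
open import Relation.Nullary.Decidable using (⌊_⌋; isYes≗does; does-⇔; dec-true; dec-false)
open import Relation.Binary.PropositionalEquality as ≡
  using (_≡_; refl; sym; trans; cong; cong₂; subst; module ≡-Reasoning)

module CommutativeSums {A : Set} {_∙_ : A → A → A} {ε : A}
                       (isCM : IsCommutativeMonoid _≡_ _∙_ ε) where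

  private
    monoid : CommutativeMonoid 0ℓ 0ℓ
    monoid = record { isCommutativeMonoid = isCM }
  open IsCommutativeMonoid isCM using (identityˡ; assoc)
  open import Algebra.Properties.CommutativeSemigroup
    (CommutativeMonoid.commutativeSemigroup monoid) using (interchange)

  total : List A → A
  total = foldr _∙_ ε

  total-++ : ∀ xs ys → total (xs ++ ys) ≡ total xs ∙ total ys
  total-++ []       ys = sym (identityˡ _)
  total-++ (x ∷ xs) ys = trans (cong (x ∙_) (total-++ xs ys)) (sym (assoc _ _ _))

  total-↭ : ∀ {xs ys} → xs ↭ ys → total xs ≡ total ys
  total-↭ p = PermSetoidP.foldr-commMonoid (≡.setoid A) isCM (↭⇒↭ₛ p)

  total-map-↭ : ∀ {B : Set} (f : B → A) {xs ys} → xs ↭ ys →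
                total (map f xs) ≡ total (map f ys)
  total-map-↭ f p = total-↭ (PermP.map⁺ f p)

  total-map-∙ : ∀ {B : Set} (f g : B → A) xs →
                total (map (λ x → f x ∙ g x) xs) ≡ total (map f xs) ∙ total (map g xs)
  total-map-∙ f g []       = sym (identityˡ ε)
  total-map-∙ f g (x ∷ xs) = trans (cong ((f x ∙ g x) ∙_) (total-map-∙ f g xs))
                                   (interchange (f x) (g x) _ _)

  module _ {B : Set} (h : B × B → A) (h-sym : ∀ x y → h (x , y) ≡ h (y , x)) where

    pairTotal : List B → A
    pairTotal xs = total (map h (pairsOf xs))

    starTotal : B → List B → A
    starTotal x ys = total (map (λ y → h (x , y)) ys)

    pairTotal-∷ : ∀ x xs → pairTotal (x ∷ xs) ≡ starTotal x xs ∙ pairTotal xs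
    pairTotal-∷ x xs = begin
      total (map h (map (x ,_) xs ++ pairsOf xs))
        ≡⟨ cong total (ListP.map-++ h (map (x ,_) xs) (pairsOf xs)) ⟩
      total (map h (map (x ,_) xs) ++ map h (pairsOf xs))
        ≡⟨ total-++ (map h (map (x ,_) xs)) (map h (pairsOf xs)) ⟩
      total (map h (map (x ,_) xs)) ∙ pairTotal xs
        ≡⟨ cong (λ ys → total ys ∙ pairTotal xs) (sym (ListP.map-∘ xs)) ⟩
      starTotal x xs ∙ pairTotal xs ∎
      where open ≡-Reasoning

    -- for symmetric h, the sum over unordered pairs only depends on the
    -- multiset of elements: a swap of neighbours only reorients one pair
    pairTotal-↭ : ∀ {xs ys} → xs ↭ ys → pairTotal xs ≡ pairTotal ys
    pairTotal-↭ Perm.refl = refl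
    pairTotal-↭ {x ∷ xs} {.x ∷ ys} (Perm.prep x p) = begin
      pairTotal (x ∷ xs)             ≡⟨ pairTotal-∷ x xs ⟩
      starTotal x xs ∙ pairTotal xs  ≡⟨ cong₂ _∙_ (total-map-↭ _ p) (pairTotal-↭ p) ⟩
      starTotal x ys ∙ pairTotal ys  ≡⟨ pairTotal-∷ x ys ⟨
      pairTotal (x ∷ ys)             ∎
      where open ≡-Reasoning
    pairTotal-↭ {x ∷ y ∷ xs} {.y ∷ .x ∷ ys} (Perm.swap x y p) = begin
      pairTotal (x ∷ y ∷ xs)
        ≡⟨ trans (pairTotal-∷ x (y ∷ xs)) (cong (starTotal x (y ∷ xs) ∙_) (pairTotal-∷ y xs)) ⟩
      (h (x , y) ∙ starTotal x xs) ∙ (starTotal y xs ∙ pairTotal xs)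
        ≡⟨ interchange (h (x , y)) _ _ _ ⟩
      (h (x , y) ∙ starTotal y xs) ∙ (starTotal x xs ∙ pairTotal xs)
        ≡⟨ cong₂ _∙_ (cong₂ _∙_ (h-sym x y) (total-map-↭ _ p))
                     (cong₂ _∙_ (total-map-↭ _ p) (pairTotal-↭ p)) ⟩
      (h (y , x) ∙ starTotal y ys) ∙ (starTotal x ys ∙ pairTotal ys)
        ≡⟨ trans (pairTotal-∷ y (x ∷ ys)) (cong (starTotal y (x ∷ ys) ∙_) (pairTotal-∷ x ys)) ⟨
      pairTotal (y ∷ x ∷ ys) ∎
      where open ≡-Reasoning
    pairTotal-↭ (Perm.trans p q) = trans (pairTotal-↭ p) (pairTotal-↭ q)

module ℕSum = CommutativeSums ℕP.+-0-isCommutativeMonoid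
module ℚSum = CommutativeSums ℚP.+-0-isCommutativeMonoid

-- Counting is summing 0/1-values, so the sum lemmas transfer to countB.
countB-total : ∀ {X : Set} (p : X → Bool) xs → countB p xs ≡ ℕSum.total (map (λ x → bval (p x)) xs)
countB-total p []       = refl
countB-total p (x ∷ xs) with p x
... | true  = cong suc (countB-total p xs)
... | false = countB-total p xs

countB-↭ : ∀ {X : Set} (p : X → Bool) {xs ys} → xs ↭ ys → countB p xs ≡ countB p ys
countB-↭ p {xs} {ys} q =
  trans (countB-total p xs) (trans (ℕSum.total-map-↭ _ q) (sym (countB-total p ys)))

countB-map : ∀ {X Y : Set} (p : Y → Bool) (f : X → Y) xs →
             countB p (map f xs) ≡ countB (λ x → p (f x)) xs
countB-map p f []       = refl
countB-map p f (x ∷ xs) with p (f x)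
... | true  = cong suc (countB-map p f xs)
... | false = countB-map p f xs

countB-cong : ∀ {X : Set} {p q : X → Bool} → (∀ x → p x ≡ q x) → ∀ xs → countB p xs ≡ countB q xs
countB-cong p≗q xs = trans (countB-total _ xs)
  (trans (cong ℕSum.total (ListP.map-cong (λ x → cong bval (p≗q x)) xs)) (sym (countB-total _ xs)))

countB-split : ∀ {X : Set} (r p q : X → Bool) → (∀ x → bval (r x) ≡ bval (p x) + bval (q x)) →
               ∀ xs → countB r xs ≡ countB p xs + countB q xs
countB-split r p q split xs = begin
  countB r xs                                                    ≡⟨ countB-total r xs ⟩
  ℕSum.total (map (λ x → bval (r x)) xs)                         ≡⟨ cong ℕSum.total (ListP.map-cong split xs) ⟩
  ℕSum.total (map (λ x → bval (p x) + bval (q x)) xs)            ≡⟨ ℕSum.total-map-∙ _ _ xs ⟩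
  ℕSum.total (map (λ x → bval (p x)) xs) + ℕSum.total (map (λ x → bval (q x)) xs)
                                                                 ≡⟨ cong₂ _+_ (countB-total p xs) (countB-total q xs) ⟨
  countB p xs + countB q xs                                      ∎
  where open ≡-Reasoning

countB-pairs-↭ : ∀ {X : Set} (q : X × X → Bool) → (∀ x y → q (x , y) ≡ q (y , x)) →
                 ∀ {xs ys} → xs ↭ ys → countB q (pairsOf xs) ≡ countB q (pairsOf ys)
countB-pairs-↭ q q-sym {xs} {ys} p = trans (countB-total q (pairsOf xs))
  (trans (ℕSum.pairTotal-↭ (λ e → bval (q e)) (λ x y → cong bval (q-sym x y)) p)
         (sym (countB-total q (pairsOf ys))))

unique-sameElems-↭ : ∀ {X : Set} {xs ys : List X} → Unique xs → Unique ys →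
                     (∀ x → x ∈ xs → x ∈ ys) → (∀ x → x ∈ ys → x ∈ xs) → xs ↭ ys
unique-sameElems-↭ u v to from = ∼bag⇒↭ (unique∧set⇒bag u v (λ {x} → mk⇔ (to x) (from x)))

map-bijection-↭ : ∀ {X : Set} (f g : X → X) → (∀ x → f (g x) ≡ x) → (∀ x → g (f x) ≡ x) →
                  ∀ {xs} → Unique xs → (∀ x → x ∈ xs) → map f xs ↭ xs
map-bijection-↭ f g fg gf u complete = unique-sameElems-↭ (UniqueP.map⁺ f-injective u) u
  (λ x _ → complete x) (λ x _ → subst (_∈ map f _) (fg x) (∈-map⁺ f (complete (g x))))
  where
  f-injective : ∀ {a b} → f a ≡ f b → a ≡ b
  f-injective {a} {b} e = trans (sym (gf a)) (trans (cong g e) (gf b))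

countB-reindex : ∀ {X : Set} (p : X → Bool) (f g : X → X) → (∀ x → f (g x) ≡ x) → (∀ x → g (f x) ≡ x) →
                 ∀ {xs} → Unique xs → (∀ x → x ∈ xs) → countB p xs ≡ countB (λ x → p (f x)) xs
countB-reindex p f g fg gf {xs} u complete =
  trans (sym (countB-↭ p (map-bijection-↭ f g fg gf u complete))) (countB-map p f xs)

fins : (m : ℕ) → List (Fin m)
fins m = toList (allFin m)

toList-tabulate : ∀ {m} {X : Set} (f : Fin m → X) → toList (Vec.tabulate f) ≡ Data.List.tabulate f
toList-tabulate {zero}  f = refl
toList-tabulate {suc m} f = cong (f Fin.zero ∷_) (toList-tabulate (λ i → f (Fin.suc i)))

fins-unique : ∀ m → Unique (fins m)
fins-unique m = subst Unique (sym (toList-tabulate {m} (λ i → i))) (UniqueP.allFin⁺ m)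

fins-complete : ∀ {m} (j : Fin m) → j ∈ fins m
fins-complete {m} j = subst (j ∈_) (sym (toList-tabulate {m} (λ i → i))) (∈-allFin j)

countB-fins-perm : ∀ {m} (π : Permutation′ m) (p : Fin m → Bool) →
                   countB p (fins m) ≡ countB (λ l → p (π ⟨$⟩ʳ l)) (fins m)
countB-fins-perm {m} π p =
  countB-reindex p (π ⟨$⟩ʳ_) (π ⟨$⟩ˡ_) (λ _ → inverseʳ π) (λ _ → inverseˡ π) (fins-unique m) fins-complete

allVec-complete : ∀ {m} (v : Vec Bool m) → v ∈ allVec m
allVec-complete []                = here refl
allVec-complete {suc m} (true ∷ v)  = ∈-++⁺ˡ (∈-map⁺ (true ∷_) (allVec-complete v))
allVec-complete {suc m} (false ∷ v) = ∈-++⁺ʳ (map (true ∷_) (allVec m)) (∈-map⁺ (false ∷_) (allVec-complete v))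

allVec-unique : ∀ m → Unique (allVec m)
allVec-unique zero    = All.[] ∷ []
allVec-unique (suc m) = UniqueP.++⁺ (UniqueP.map⁺ VecP.∷-injectiveʳ (allVec-unique m))
                                    (UniqueP.map⁺ VecP.∷-injectiveʳ (allVec-unique m)) heads-differ
  where
  heads-differ : ∀ {v} → v ∈ map (true ∷_) (allVec m) × v ∈ map (false ∷_) (allVec m) → ⊥
  heads-differ (a , b) with ∈-map⁻ (true ∷_) a | ∈-map⁻ (false ∷_) b
  ... | _ , _ , refl | _ , _ , ()

concatMap-unique : ∀ {X Y : Set} (g : X → List Y) (tag : Y → X) → (∀ x y → y ∈ g x → tag y ≡ x) →
                   (∀ x → Unique (g x)) → ∀ {xs} → Unique xs → Unique (concatMap g xs)
concatMap-unique g tag tagged blocks {[]}     []       = []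
concatMap-unique g tag tagged blocks {x ∷ xs} (x∉xs ∷ u) =
  UniqueP.++⁺ (blocks x) (concatMap-unique g tag tagged blocks u) disjoint
  where
  disjoint : ∀ {y} → y ∈ g x × y ∈ concatMap g xs → ⊥
  disjoint {y} (y∈gx , y∈rest) with find (∈-concatMap⁻ g {xs = xs} y∈rest)
  ... | x′ , x′∈xs , y∈gx′ = All.lookup x∉xs x′∈xs (trans (sym (tagged x y y∈gx)) (tagged x′ y y∈gx′))

-- The cells of the n × m grid at which q holds, in row-major order;
-- edges A is cellsWhere (entry A) by definition.
cellIf : ∀ {n m} → (Fin n → Fin m → Bool) → Fin n → Fin m → List (Edge n m)
cellIf q i j = if q i j then (i , j) ∷ [] else []

rowCells : ∀ {n m} → (Fin n → Fin m → Bool) → Fin n → List (Edge n m)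
rowCells {m = m} q i = concatMap (cellIf q i) (fins m)

cellsWhere : ∀ {n m} → (Fin n → Fin m → Bool) → List (Edge n m)
cellsWhere {n} q = concatMap (rowCells q) (fins n)

private
  ∈-cellIf : ∀ {n m} (q : Fin n → Fin m → Bool) i j e → e ∈ cellIf q i j → e ≡ (i , j) × q i j ≡ true
  ∈-cellIf q i j e e∈ with q i j | e∈
  ... | true | here e≡ij = e≡ij , refl

  cellIf-unique : ∀ {n m} (q : Fin n → Fin m → Bool) i j → Unique (cellIf q i j)
  cellIf-unique q i j with q i j
  ... | true  = All.[] ∷ []
  ... | false = []

cellsWhere-unique : ∀ {n m} (q : Fin n → Fin m → Bool) → Unique (cellsWhere q)
cellsWhere-unique {n} {m} q =
  concatMap-unique (rowCells q) proj₁ row-tag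
    (λ i → concatMap-unique (cellIf q i) proj₂ column-tag (cellIf-unique q i) (fins-unique m))
    (fins-unique n)
  where
  column-tag : ∀ {i} j e → e ∈ cellIf q i j → proj₂ e ≡ j
  column-tag {i} j e e∈ = cong proj₂ (proj₁ (∈-cellIf q i j e e∈))
  row-tag : ∀ i e → e ∈ rowCells q i → proj₁ e ≡ i
  row-tag i e e∈ with find (∈-concatMap⁻ (cellIf q i) {xs = fins m} e∈)
  ... | j , _ , e∈′ = cong proj₁ (proj₁ (∈-cellIf q i j e e∈′))

∈-cellsWhere⁻ : ∀ {n m} (q : Fin n → Fin m → Bool) i j → (i , j) ∈ cellsWhere q → q i j ≡ true
∈-cellsWhere⁻ {n} {m} q i j ij∈ with find (∈-concatMap⁻ (rowCells q) {xs = fins n} ij∈)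
... | i′ , _ , ij∈row with find (∈-concatMap⁻ (cellIf q i′) {xs = fins m} ij∈row)
...   | j′ , _ , ij∈cell with ∈-cellIf q i′ j′ _ ij∈cell
...     | refl , qij = qij

∈-cellsWhere⁺ : ∀ {n m} (q : Fin n → Fin m → Bool) i j → q i j ≡ true → (i , j) ∈ cellsWhere q
∈-cellsWhere⁺ q i j qij =
  ∈-concatMap⁺ (rowCells q) (lose (fins-complete i) (∈-concatMap⁺ (cellIf q i) (lose (fins-complete j) ij∈cell)))
  where
  ij∈cell : (i , j) ∈ cellIf q i j
  ij∈cell rewrite qij = here refl

⌊⌋-⇔ : ∀ {P Q : Set} → P ⇔ Q → (p? : Dec P) (q? : Dec Q) → ⌊ p? ⌋ ≡ ⌊ q? ⌋
⌊⌋-⇔ P⇔Q p? q? = trans (isYes≗does p?) (trans (does-⇔ P⇔Q p? q?) (sym (isYes≗does q?)))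

sameFin : ∀ {n} → Fin n → Fin n → Bool
sameFin a b = does (a ≟ b)

sameFin-refl : ∀ {n} (a : Fin n) → sameFin a a ≡ true
sameFin-refl a = dec-true (a ≟ a) refl

sameFin-≢ : ∀ {n} {a b : Fin n} → ¬ a ≡ b → sameFin a b ≡ false
sameFin-≢ {a = a} {b} a≢b = dec-false (a ≟ b) a≢b

permutation-injective : ∀ {n} (π : Permutation′ n) {a b} → π ⟨$⟩ʳ a ≡ π ⟨$⟩ʳ b → a ≡ b
permutation-injective π {a} {b} e = trans (sym (inverseˡ π)) (trans (cong (π ⟨$⟩ˡ_) e) (inverseˡ π))

sameFin-perm : ∀ {n} (π : Permutation′ n) a b → sameFin (π ⟨$⟩ʳ a) (π ⟨$⟩ʳ b) ≡ sameFin a b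
sameFin-perm π a b = does-⇔ (mk⇔ (permutation-injective π) (cong (π ⟨$⟩ʳ_))) ((π ⟨$⟩ʳ a) ≟ (π ⟨$⟩ʳ b)) (a ≟ b)

lookup-update : ∀ {n} {X : Set} (xs : Vec X n) i y a →
                lookup (xs [ i ]≔ y) a ≡ (if sameFin a i then y else lookup xs a)
lookup-update xs i y a with a ≟ i
... | yes refl = VecP.lookup∘update a xs y
... | no a≢i   = VecP.lookup∘update′ a≢i xs y

entry-setEntry : ∀ {n m} (A : Mat n m) i j b a c →
                 entry (setEntry A i j b) a c ≡ (if sameFin a i ∧ sameFin c j then b else entry A a c)
entry-setEntry A i j b a c rewrite lookup-update A i (lookup A i [ j ]≔ b) a with a ≟ i
... | yes refl = lookup-update (lookup A a) j b c
... | no _     = refl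

matrix-ext : ∀ {n m} {X Y : Mat n m} → (∀ a b → entry X a b ≡ entry Y a b) → X ≡ Y
matrix-ext {X = X} {Y} X≗Y = begin
  X                                                       ≡⟨ tabulate-entries X ⟨
  Vec.tabulate (λ a → Vec.tabulate (λ b → entry X a b))   ≡⟨ VecP.tabulate-cong (λ a → VecP.tabulate-cong (X≗Y a)) ⟩
  Vec.tabulate (λ a → Vec.tabulate (λ b → entry Y a b))   ≡⟨ tabulate-entries Y ⟩
  Y                                                       ∎
  where
  open ≡-Reasoning
  tabulate-entries : ∀ Z → Vec.tabulate (λ a → Vec.tabulate (λ b → entry Z a b)) ≡ Z
  tabulate-entries Z = trans (VecP.tabulate-cong (λ a → VecP.tabulate∘lookup (lookup Z a))) (VecP.tabulate∘lookup Z)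

eqMat-injective : ∀ {n m} (f : Mat n m → Mat n m) → (∀ {X Y} → f X ≡ f Y → X ≡ Y) →
                  ∀ X Y → eqMat (f X) (f Y) ≡ eqMat X Y
eqMat-injective f f-inj X Y = ⌊⌋-⇔ (mk⇔ f-inj (cong f)) _ _

relabel : ∀ {n m} → Permutation′ n → Permutation′ m → Mat n m → Mat n m
relabel π₁ π₂ A = Vec.tabulate (λ a → Vec.tabulate (λ b → entry A (π₁ ⟨$⟩ʳ a) (π₂ ⟨$⟩ʳ b)))

entry-relabel : ∀ {n m} π₁ π₂ (A : Mat n m) a b → entry (relabel π₁ π₂ A) a b ≡ entry A (π₁ ⟨$⟩ʳ a) (π₂ ⟨$⟩ʳ b)
entry-relabel π₁ π₂ A a b
  rewrite VecP.lookup∘tabulate (λ a → Vec.tabulate (λ b → entry A (π₁ ⟨$⟩ʳ a) (π₂ ⟨$⟩ʳ b))) a =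
  VecP.lookup∘tabulate (λ b → entry A (π₁ ⟨$⟩ʳ a) (π₂ ⟨$⟩ʳ b)) b

relabel-flip-relabel : ∀ {n m} π₁ π₂ (A : Mat n m) → relabel (flip π₁) (flip π₂) (relabel π₁ π₂ A) ≡ A
relabel-flip-relabel π₁ π₂ A = matrix-ext λ a b → trans (entry-relabel (flip π₁) (flip π₂) (relabel π₁ π₂ A) a b)
  (trans (entry-relabel π₁ π₂ A _ _) (cong₂ (entry A) (inverseʳ π₁) (inverseʳ π₂)))

relabel-relabel-flip : ∀ {n m} π₁ π₂ (A : Mat n m) → relabel π₁ π₂ (relabel (flip π₁) (flip π₂) A) ≡ A
relabel-relabel-flip π₁ π₂ A = matrix-ext λ a b → trans (entry-relabel π₁ π₂ (relabel (flip π₁) (flip π₂) A) a b)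
  (trans (entry-relabel (flip π₁) (flip π₂) A _ _) (cong₂ (entry A) (inverseˡ π₁) (inverseˡ π₂)))

relabel-injective : ∀ {n m} π₁ π₂ {X Y : Mat n m} → relabel π₁ π₂ X ≡ relabel π₁ π₂ Y → X ≡ Y
relabel-injective π₁ π₂ {X} {Y} e = trans (sym (relabel-flip-relabel π₁ π₂ X))
  (trans (cong (relabel (flip π₁) (flip π₂)) e) (relabel-flip-relabel π₁ π₂ Y))

relabel-setEntry : ∀ {n m} π₁ π₂ (X : Mat n m) i j b →
  relabel π₁ π₂ (setEntry X (π₁ ⟨$⟩ʳ i) (π₂ ⟨$⟩ʳ j) b) ≡ setEntry (relabel π₁ π₂ X) i j b
relabel-setEntry {n} {m} π₁ π₂ X i j b = matrix-ext λ a c → begin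
  entry (relabel π₁ π₂ (setEntry X (p₁ i) (p₂ j) b)) a c
    ≡⟨ entry-relabel π₁ π₂ (setEntry X (p₁ i) (p₂ j) b) a c ⟩
  entry (setEntry X (p₁ i) (p₂ j) b) (p₁ a) (p₂ c)
    ≡⟨ entry-setEntry X (p₁ i) (p₂ j) b (p₁ a) (p₂ c) ⟩
  (if sameFin (p₁ a) (p₁ i) ∧ sameFin (p₂ c) (p₂ j) then b else entry X (p₁ a) (p₂ c))
    ≡⟨ cong₂ (λ u v → if u ∧ v then b else entry X (p₁ a) (p₂ c)) (sameFin-perm π₁ a i) (sameFin-perm π₂ c j) ⟩
  (if sameFin a i ∧ sameFin c j then b else entry X (p₁ a) (p₂ c))
    ≡⟨ cong (if sameFin a i ∧ sameFin c j then b else_) (entry-relabel π₁ π₂ X a c) ⟨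
  (if sameFin a i ∧ sameFin c j then b else entry (relabel π₁ π₂ X) a c)
    ≡⟨ entry-setEntry (relabel π₁ π₂ X) i j b a c ⟨
  entry (setEntry (relabel π₁ π₂ X) i j b) a c ∎
  where
  open ≡-Reasoning
  p₁ : Fin n → Fin n
  p₁ = π₁ ⟨$⟩ʳ_
  p₂ : Fin m → Fin m
  p₂ = π₂ ⟨$⟩ʳ_

relabelEdge : ∀ {n m} → Permutation′ n → Permutation′ m → Edge n m → Edge n m
relabelEdge π₁ π₂ (a , b) = (π₁ ⟨$⟩ʳ a , π₂ ⟨$⟩ʳ b)

edges-relabel-↭ : ∀ {n m} π₁ π₂ (A : Mat n m) → map (relabelEdge π₁ π₂) (edges (relabel π₁ π₂ A)) ↭ edges A
edges-relabel-↭ π₁ π₂ A =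
  unique-sameElems-↭ (UniqueP.map⁺ injective (cellsWhere-unique _)) (cellsWhere-unique _) to from
  where
  injective : ∀ {x y} → relabelEdge π₁ π₂ x ≡ relabelEdge π₁ π₂ y → x ≡ y
  injective e = cong₂ _,_ (permutation-injective π₁ (cong proj₁ e)) (permutation-injective π₂ (cong proj₂ e))
  to : ∀ x → x ∈ map (relabelEdge π₁ π₂) (edges (relabel π₁ π₂ A)) → x ∈ edges A
  to x x∈ with ∈-map⁻ (relabelEdge π₁ π₂) x∈
  ... | (a , b) , ab∈ , refl = ∈-cellsWhere⁺ (entry A) _ _
    (trans (sym (entry-relabel π₁ π₂ A a b)) (∈-cellsWhere⁻ (entry (relabel π₁ π₂ A)) a b ab∈))
  from : ∀ x → x ∈ edges A → x ∈ map (relabelEdge π₁ π₂) (edges (relabel π₁ π₂ A))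
  from (i , j) ij∈ = subst (_∈ map (relabelEdge π₁ π₂) (edges (relabel π₁ π₂ A)))
    (cong₂ _,_ (inverseʳ π₁) (inverseʳ π₂))
    (∈-map⁺ (relabelEdge π₁ π₂) (∈-cellsWhere⁺ (entry (relabel π₁ π₂ A)) _ _
      (trans (entry-relabel π₁ π₂ A _ _)
             (trans (cong₂ (entry A) (inverseʳ π₁) (inverseʳ π₂)) (∈-cellsWhere⁻ (entry A) i j ij∈)))))

switched : ∀ {n m} → Mat n m → Edge n m → Edge n m → Mat n m
switched A (i , j) (i′ , j′) =
  setEntry (setEntry (setEntry (setEntry A i j false) i′ j′ false) i j′ true) i′ j true

atCell : ∀ {n m} → Fin n → Fin m → Edge n m → Bool
atCell a c (i , j) = sameFin a i ∧ sameFin c j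

entry-switched : ∀ {n m} (A : Mat n m) i j i′ j′ a c → entry (switched A (i , j) (i′ , j′)) a c ≡
  (if atCell a c (i′ , j) then true else if atCell a c (i , j′) then true
   else if atCell a c (i′ , j′) then false else if atCell a c (i , j) then false else entry A a c)
entry-switched {n} {m} A i j i′ j′ a c = begin
  entry (setEntry M₃ i′ j true) a c
    ≡⟨ entry-setEntry M₃ i′ j true a c ⟩
  (if atCell a c (i′ , j) then true else entry M₃ a c)
    ≡⟨ cong (if atCell a c (i′ , j) then true else_) (entry-setEntry M₂ i j′ true a c) ⟩
  (if atCell a c (i′ , j) then true else if atCell a c (i , j′) then true else entry M₂ a c)
    ≡⟨ cong (λ t → if atCell a c (i′ , j) then true else if atCell a c (i , j′) then true else t)
            (entry-setEntry M₁ i′ j′ false a c) ⟩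
  (if atCell a c (i′ , j) then true else if atCell a c (i , j′) then true
   else if atCell a c (i′ , j′) then false else entry M₁ a c)
    ≡⟨ cong (λ t → if atCell a c (i′ , j) then true else if atCell a c (i , j′) then true
                   else if atCell a c (i′ , j′) then false else t)
            (entry-setEntry A i j false a c) ⟩
  (if atCell a c (i′ , j) then true else if atCell a c (i , j′) then true
   else if atCell a c (i′ , j′) then false else if atCell a c (i , j) then false else entry A a c) ∎
  where
  open ≡-Reasoning
  M₁ M₂ M₃ : Mat n m
  M₁ = setEntry A i j false
  M₂ = setEntry M₁ i′ j′ false
  M₃ = setEntry M₂ i j′ true

-- Overwriting with true has priority over overwriting with false, and
-- overwrites with the same value may be performed in either order.
reorder-overwrites : ∀ (f₁ f₂ t₁ t₂ x : Bool) →
  (if t₂ then true else if t₁ then true else if f₂ then false else if f₁ then false else x) ≡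
  (if t₁ then true else if t₂ then true else if f₁ then false else if f₂ then false else x)
reorder-overwrites f₁     f₂     true  true  x = refl
reorder-overwrites f₁     f₂     true  false x = refl
reorder-overwrites f₁     f₂     false true  x = refl
reorder-overwrites true   true   false false x = refl
reorder-overwrites true   false  false false x = refl
reorder-overwrites false  true   false false x = refl
reorder-overwrites false  false  false false x = refl

switched-sym : ∀ {n m} (A : Mat n m) e f → switched A e f ≡ switched A f e
switched-sym A (i , j) (i′ , j′) = matrix-ext λ a c →
  trans (entry-switched A i j i′ j′ a c)
  (trans (reorder-overwrites (atCell a c (i , j)) (atCell a c (i′ , j′)) (atCell a c (i , j′)) (atCell a c (i′ , j)) (entry A a c))
         (sym (entry-switched A i′ j′ i j a c)))

switchStep-sym : ∀ {n m} (A : Mat n m) e f → switchStep A e f ≡ switchStep A f e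
switchStep-sym A (i , j) (i′ , j′)
  rewrite BoolP.∧-comm (not (entry A i j′)) (not (entry A i′ j))
  with not (entry A i′ j) ∧ not (entry A i j′)
... | false = refl
... | true  = switched-sym A (i , j) (i′ , j′)

switched-relabel : ∀ {n m} π₁ π₂ (A : Mat n m) e f →
  switched (relabel π₁ π₂ A) e f ≡ relabel π₁ π₂ (switched A (relabelEdge π₁ π₂ e) (relabelEdge π₁ π₂ f))
switched-relabel {n} {m} π₁ π₂ A (i , j) (i′ , j′) = sym (begin
  relabel π₁ π₂ (setEntry Y₃ (p₁ i′) (p₂ j) true)
    ≡⟨ relabel-setEntry π₁ π₂ Y₃ i′ j true ⟩
  setEntry (relabel π₁ π₂ Y₃) i′ j true
    ≡⟨ cong (λ X → setEntry X i′ j true) (relabel-setEntry π₁ π₂ Y₂ i j′ true) ⟩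
  setEntry (setEntry (relabel π₁ π₂ Y₂) i j′ true) i′ j true
    ≡⟨ cong (λ X → setEntry (setEntry X i j′ true) i′ j true) (relabel-setEntry π₁ π₂ Y₁ i′ j′ false) ⟩
  setEntry (setEntry (setEntry (relabel π₁ π₂ Y₁) i′ j′ false) i j′ true) i′ j true
    ≡⟨ cong (λ X → setEntry (setEntry (setEntry X i′ j′ false) i j′ true) i′ j true)
            (relabel-setEntry π₁ π₂ A i j false) ⟩
  switched (relabel π₁ π₂ A) (i , j) (i′ , j′) ∎)
  where
  open ≡-Reasoning
  p₁ : Fin n → Fin n
  p₁ = π₁ ⟨$⟩ʳ_
  p₂ : Fin m → Fin m
  p₂ = π₂ ⟨$⟩ʳ_
  Y₁ Y₂ Y₃ : Mat n m
  Y₁ = setEntry A (p₁ i) (p₂ j) false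
  Y₂ = setEntry Y₁ (p₁ i′) (p₂ j′) false
  Y₃ = setEntry Y₂ (p₁ i) (p₂ j′) true

switchStep-relabel : ∀ {n m} π₁ π₂ (A : Mat n m) e f →
  switchStep (relabel π₁ π₂ A) e f ≡ relabel π₁ π₂ (switchStep A (relabelEdge π₁ π₂ e) (relabelEdge π₁ π₂ f))
switchStep-relabel π₁ π₂ A (i , j) (i′ , j′)
  rewrite entry-relabel π₁ π₂ A i j′ | entry-relabel π₁ π₂ A i′ j
  with not (entry A (π₁ ⟨$⟩ʳ i) (π₂ ⟨$⟩ʳ j′)) ∧ not (entry A (π₁ ⟨$⟩ʳ i′) (π₂ ⟨$⟩ʳ j))
... | false = refl
... | true  = switched-relabel π₁ π₂ A (i , j) (i′ , j′)

pairsOf-map : ∀ {X Y : Set} (f : X → Y) xs →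
              pairsOf (map f xs) ≡ map (λ p → (f (proj₁ p) , f (proj₂ p))) (pairsOf xs)
pairsOf-map f []       = refl
pairsOf-map {X} {Y} f (x ∷ xs) = sym (begin
  map f² (map (x ,_) xs ++ pairsOf xs)              ≡⟨ ListP.map-++ f² (map (x ,_) xs) (pairsOf xs) ⟩
  map f² (map (x ,_) xs) ++ map f² (pairsOf xs)     ≡⟨ cong₂ _++_ (sym (ListP.map-∘ xs)) (sym (pairsOf-map f xs)) ⟩
  map (λ y → (f x , f y)) xs ++ pairsOf (map f xs)  ≡⟨ cong (_++ pairsOf (map f xs)) (ListP.map-∘ xs) ⟩
  map (f x ,_) (map f xs) ++ pairsOf (map f xs)     ∎)
  where
  open ≡-Reasoning
  f² : X × X → Y × Y
  f² (a , b) = (f a , f b)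

-- P^S with the with-abstractions of its definition made explicit:
-- d = (|E| choose 2) and ps is the list of unordered pairs of edges.
switchProb : ∀ {n m} → ℕ → List (Edge n m × Edge n m) → Mat n m → Mat n m → ℚ
switchProb zero    ps G K = indicator (eqMat G K)
switchProb (suc d) ps G K = frac (countB (λ ef → eqMat (switchStep G (proj₁ ef) (proj₂ ef)) K) ps) (suc d)

PS-unfold : ∀ {n m} (G K : Mat n m) → PS G K ≡ switchProb (length (edges G) C 2) (pairsOf (edges G)) G K
PS-unfold G K with edges G
... | es with pairsOf es | length es C 2
...   | ps | zero  = refl
...   | ps | suc d = cong (λ k → frac k (suc d)) (countB-cong (λ { (e , f) → refl }) ps)

edgeCount-relabel : ∀ {n m} π₁ π₂ (A : Mat n m) → length (edges (relabel π₁ π₂ A)) ≡ length (edges A)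
edgeCount-relabel π₁ π₂ A = trans (sym (ListP.length-map (relabelEdge π₁ π₂) (edges (relabel π₁ π₂ A))))
                                  (PermP.↭-length (edges-relabel-↭ π₁ π₂ A))

switchCount-relabel : ∀ {n m} π₁ π₂ (A K : Mat n m) →
  countB (λ ef → eqMat (switchStep (relabel π₁ π₂ A) (proj₁ ef) (proj₂ ef)) (relabel π₁ π₂ K))
         (pairsOf (edges (relabel π₁ π₂ A)))
  ≡ countB (λ ef → eqMat (switchStep A (proj₁ ef) (proj₂ ef)) K) (pairsOf (edges A))
switchCount-relabel {n} {m} π₁ π₂ A K = begin
  countB (λ ef → eqMat (switchStep A′ (proj₁ ef) (proj₂ ef)) K′) (pairsOf (edges A′))
    ≡⟨ countB-cong (λ { (e , f) → trans (cong (λ X → eqMat X K′) (switchStep-relabel π₁ π₂ A e f))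
                                        (eqMat-injective (relabel π₁ π₂) (relabel-injective π₁ π₂) _ K) })
                   (pairsOf (edges A′)) ⟩
  countB (λ ef → switchesTo (relabelPair ef)) (pairsOf (edges A′))
    ≡⟨ countB-map switchesTo relabelPair (pairsOf (edges A′)) ⟨
  countB switchesTo (map relabelPair (pairsOf (edges A′)))
    ≡⟨ cong (countB switchesTo) (pairsOf-map (relabelEdge π₁ π₂) (edges A′)) ⟨
  countB switchesTo (pairsOf (map (relabelEdge π₁ π₂) (edges A′)))
    ≡⟨ countB-pairs-↭ switchesTo (λ e f → cong (λ X → eqMat X K) (switchStep-sym A e f))
                      (edges-relabel-↭ π₁ π₂ A) ⟩
  countB switchesTo (pairsOf (edges A)) ∎
  where
  open ≡-Reasoning
  A′ K′ : Mat n m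
  A′ = relabel π₁ π₂ A
  K′ = relabel π₁ π₂ K
  relabelPair : Edge n m × Edge n m → Edge n m × Edge n m
  relabelPair (e , f) = (relabelEdge π₁ π₂ e , relabelEdge π₁ π₂ f)
  switchesTo : Edge n m × Edge n m → Bool
  switchesTo ef = eqMat (switchStep A (proj₁ ef) (proj₂ ef)) K

PS-relabel : ∀ {n m} π₁ π₂ (A K : Mat n m) → PS (relabel π₁ π₂ A) (relabel π₁ π₂ K) ≡ PS A K
PS-relabel {n} {m} π₁ π₂ A K = begin
  PS A′ K′                                                      ≡⟨ PS-unfold A′ K′ ⟩
  switchProb (length (edges A′) C 2) (pairsOf (edges A′)) A′ K′
    ≡⟨ cong (λ l → switchProb (l C 2) (pairsOf (edges A′)) A′ K′) (edgeCount-relabel π₁ π₂ A) ⟩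
  switchProb (length (edges A) C 2) (pairsOf (edges A′)) A′ K′  ≡⟨ same-prob (length (edges A) C 2) ⟩
  switchProb (length (edges A) C 2) (pairsOf (edges A)) A K     ≡⟨ PS-unfold A K ⟨
  PS A K                                                        ∎
  where
  open ≡-Reasoning
  A′ K′ : Mat n m
  A′ = relabel π₁ π₂ A
  K′ = relabel π₁ π₂ K
  same-prob : ∀ d → switchProb d (pairsOf (edges A′)) A′ K′ ≡ switchProb d (pairsOf (edges A)) A K
  same-prob zero    = cong indicator (eqMat-injective (relabel π₁ π₂) (relabel-injective π₁ π₂) A K)
  same-prob (suc d) = cong (λ k → frac k (suc d)) (switchCount-relabel π₁ π₂ A K)

-- Curveball: entries of a trade.  Row j is written last, so it wins when i = j.
entry-trade : ∀ {n m} (A : Mat n m) i j T a b → entry (trade A i j T) a b ≡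
  (if sameFin a j then (if inSym A i j b then not (lookup T b) else entry A j b)
   else if sameFin a i then (if inSym A i j b then lookup T b else entry A i b) else entry A a b)
entry-trade A i j T a b
  rewrite lookup-update (A [ i ]≔ Vec.tabulate (λ l → if inSym A i j l then lookup T l else entry A i l)) j
                        (Vec.tabulate (λ l → if inSym A i j l then not (lookup T l) else entry A j l)) a
  with sameFin a j
... | true  = VecP.lookup∘tabulate (λ l → if inSym A i j l then not (lookup T l) else entry A j l) b
... | false rewrite lookup-update A i (Vec.tabulate (λ l → if inSym A i j l then lookup T l else entry A i l)) a
  with sameFin a i
...   | true  = VecP.lookup∘tabulate (λ l → if inSym A i j l then lookup T l else entry A i l) b
...   | false = refl

-- The choice for the ordered pair (j , i) that produces the same trade as
-- the choice T for (i , j): T complemented inside S_i ∪ S_j.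
mirror : ∀ {n m} → Mat n m → Fin n → Fin n → Vec Bool m → Vec Bool m
mirror A i j T = Vec.tabulate (λ l → lookup T l xor inSym A i j l)

lookup-mirror : ∀ {n m} (A : Mat n m) i j T l → lookup (mirror A i j T) l ≡ (lookup T l xor inSym A i j l)
lookup-mirror A i j T l = VecP.lookup∘tabulate (λ l → lookup T l xor inSym A i j l) l

mirror-involutive : ∀ {n m} (A : Mat n m) i j T → mirror A i j (mirror A i j T) ≡ T
mirror-involutive A i j T = trans (VecP.tabulate-cong cancel) (VecP.tabulate∘lookup T)
  where
  cancel : ∀ l → lookup (mirror A i j T) l xor inSym A i j l ≡ lookup T l
  cancel l = let s = inSym A i j l in begin
    lookup (mirror A i j T) l xor s   ≡⟨ cong (_xor s) (lookup-mirror A i j T l) ⟩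
    (lookup T l xor s) xor s          ≡⟨ BoolP.xor-assoc (lookup T l) s s ⟩
    lookup T l xor (s xor s)          ≡⟨ cong (lookup T l xor_) (BoolP.xor-same s) ⟩
    lookup T l xor false              ≡⟨ BoolP.xor-identityʳ (lookup T l) ⟩
    lookup T l                        ∎
    where open ≡-Reasoning

-- Truth tables: a mirrored choice writes row i and row j exactly as T does,
-- with the roles of the two rows exchanged (x , y are the entries of rows i , j).
mirror-row-i : ∀ x y t → (if (y xor x) then not (t xor (x xor y)) else x) ≡ (if (x xor y) then t else x)
mirror-row-i true  true  t     = refl
mirror-row-i true  false true  = refl
mirror-row-i true  false false = refl
mirror-row-i false true  true  = refl
mirror-row-i false true  false = refl
mirror-row-i false false t     = refl

mirror-row-j : ∀ x y t → (if (y xor x) then (t xor (x xor y)) else y) ≡ (if (x xor y) then not t else y)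
mirror-row-j true  true  t     = refl
mirror-row-j true  false true  = refl
mirror-row-j true  false false = refl
mirror-row-j false true  true  = refl
mirror-row-j false true  false = refl
mirror-row-j false false t     = refl

trade-mirror : ∀ {n m} (A : Mat n m) i j T → trade A j i (mirror A i j T) ≡ trade A i j T
trade-mirror A i j T = matrix-ext λ a b → trans (entry-trade A j i (mirror A i j T) a b)
  (trans (same-entry a b (a ≟ i) (a ≟ j)) (sym (entry-trade A i j T a b)))
  where
  same-entry : ∀ a b → Dec (a ≡ i) → Dec (a ≡ j) →
    (if sameFin a i then (if inSym A j i b then not (lookup (mirror A i j T) b) else entry A i b)
     else if sameFin a j then (if inSym A j i b then lookup (mirror A i j T) b else entry A j b) else entry A a b)
    ≡ (if sameFin a j then (if inSym A i j b then not (lookup T b) else entry A j b)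
     else if sameFin a i then (if inSym A i j b then lookup T b else entry A i b) else entry A a b)
  same-entry a b (yes refl) (yes refl) rewrite sameFin-refl a | BoolP.xor-same (entry A a b) = refl
  same-entry a b (yes refl) (no a≢j) rewrite sameFin-refl a | sameFin-≢ a≢j | lookup-mirror A a j T b =
    mirror-row-i (entry A a b) (entry A j b) (lookup T b)
  same-entry a b (no a≢i) (yes refl) rewrite sameFin-refl a | sameFin-≢ a≢i | lookup-mirror A i a T b =
    mirror-row-j (entry A i b) (entry A a b) (lookup T b)
  same-entry a b (no a≢i) (no a≢j) rewrite sameFin-≢ a≢i | sameFin-≢ a≢j = refl

-- Truth tables for splitting counts over S_i ∪ S_j (s marks S_i ∪ S_j,
-- t the chosen set, x , y the entries of rows i , j).
mirror-outside : ∀ t x y → ((t xor (x xor y)) ∧ not (y xor x)) ≡ (t ∧ not (x xor y))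
mirror-outside true  true  true  = refl
mirror-outside true  true  false = refl
mirror-outside true  false true  = refl
mirror-outside true  false false = refl
mirror-outside false true  true  = refl
mirror-outside false true  false = refl
mirror-outside false false true  = refl
mirror-outside false false false = refl

split-xor : ∀ t s → bval (t xor s) ≡ bval (t ∧ not s) + bval (not t ∧ s)
split-xor true  true  = refl
split-xor true  false = refl
split-xor false true  = refl
split-xor false false = refl

split-chosen : ∀ t s → bval t ≡ bval (t ∧ not s) + bval (t ∧ s)
split-chosen true  true  = refl
split-chosen true  false = refl
split-chosen false true  = refl
split-chosen false false = refl

split-marked : ∀ t s → bval s ≡ bval (not t ∧ s) + bval (t ∧ s)
split-marked true  true  = refl
split-marked true  false = refl
split-marked false true  = refl
split-marked false false = refl

split-symDiff : ∀ x y → bval (x xor y) ≡ bval (x ∧ not y) + bval (y ∧ not x)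
split-symDiff true  true  = refl
split-symDiff true  false = refl
split-symDiff false true  = refl
split-symDiff false false = refl

chosenCount : ∀ {m} → Vec Bool m → ℕ
chosenCount {m} T = countB (lookup T) (fins m)

module _ {n m} (A : Mat n m) (i j : Fin n) where

  outsideCount : Vec Bool m → ℕ
  outsideCount T = countB (λ l → lookup T l ∧ not (inSym A i j l)) (fins m)

  outside-mirror : ∀ T → countB (λ l → lookup (mirror A i j T) l ∧ not (inSym A j i l)) (fins m) ≡ outsideCount T
  outside-mirror T = countB-cong (λ l → trans (cong (λ t → t ∧ not (inSym A j i l)) (lookup-mirror A i j T l))
                                              (mirror-outside (lookup T l) (entry A i l) (entry A j l))) (fins m)

  symDiff-size : countB (inSym A i j) (fins m) ≡ sDiff A i j + sDiff A j i
  symDiff-size = countB-split _ _ _ (λ l → split-symDiff (entry A i l) (entry A j l)) (fins m)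

  -- a choice inside S_i ∪ S_j and its mirror image partition S_i ∪ S_j
  mirror-size : ∀ T → outsideCount T ≡ 0 → chosenCount T + chosenCount (mirror A i j T) ≡ sDiff A i j + sDiff A j i
  mirror-size T inside = begin
    chosenCount T + chosenCount (mirror A i j T)      ≡⟨ cong₂ _+_ chosen mirrored ⟩
    (outsideCount T + inS) + (outsideCount T + outS)  ≡⟨ cong (λ o → (o + inS) + (o + outS)) inside ⟩
    inS + outS                                        ≡⟨ ℕP.+-comm inS outS ⟩
    outS + inS                                        ≡⟨ marked ⟨
    countB (inSym A i j) (fins m)                     ≡⟨ symDiff-size ⟩
    sDiff A i j + sDiff A j i                         ∎
    where
    open ≡-Reasoning
    inS outS : ℕ
    inS  = countB (λ l → lookup T l ∧ inSym A i j l) (fins m)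
    outS = countB (λ l → not (lookup T l) ∧ inSym A i j l) (fins m)
    chosen : chosenCount T ≡ outsideCount T + inS
    chosen = countB-split _ _ _ (λ l → split-chosen (lookup T l) (inSym A i j l)) (fins m)
    mirrored : chosenCount (mirror A i j T) ≡ outsideCount T + outS
    mirrored = countB-split _ _ _ (λ l → trans (cong bval (lookup-mirror A i j T l))
                                               (split-xor (lookup T l) (inSym A i j l))) (fins m)
    marked : countB (inSym A i j) (fins m) ≡ outS + inS
    marked = countB-split _ _ _ (λ l → split-marked (lookup T l) (inSym A i j l)) (fins m)

≡ᵇ-complement : ∀ x y a b → x + y ≡ a + b → (y ≡ᵇ b) ≡ (x ≡ᵇ a)
≡ᵇ-complement x y a b sum≡ = does-⇔ (mk⇔ y≡b⇒x≡a x≡a⇒y≡b) (y ℕP.≟ b) (x ℕP.≟ a)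
  where
  y≡b⇒x≡a : y ≡ b → x ≡ a
  y≡b⇒x≡a refl = ℕP.+-cancelʳ-≡ y x a sum≡
  x≡a⇒y≡b : x ≡ a → y ≡ b
  x≡a⇒y≡b refl = ℕP.+-cancelˡ-≡ x y b sum≡

∧-cong-guarded : ∀ {u u′ v v′ : Bool} → u′ ≡ u → (u ≡ true → v′ ≡ v) → (u′ ∧ v′) ≡ (u ∧ v)
∧-cong-guarded {false} refl _ = refl
∧-cong-guarded {true}  refl f = f refl

admissible-mirror : ∀ {n m} (A : Mat n m) i j T → admissible A j i (mirror A i j T) ≡ admissible A i j T
admissible-mirror A i j T = ∧-cong-guarded (cong (_≡ᵇ 0) (outside-mirror A i j T)) λ inside →
  ≡ᵇ-complement (chosenCount T) (chosenCount (mirror A i j T)) (sDiff A i j) (sDiff A j i)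
    (mirror-size A i j T (ℕP.≡ᵇ⇒≡ (outsideCount A i j T) 0 (Equivalence.from BoolP.T-≡ inside)))

choose-swap : ∀ a b → (b + a) C b ≡ (a + b) C a
choose-swap a b = sym (begin
  (a + b) C a            ≡⟨ nCk≡nC[n∸k] (ℕP.m≤m+n a b) ⟩
  (a + b) C (a + b ∸ a)  ≡⟨ cong ((a + b) C_) (ℕP.m+n∸m≡n a b) ⟩
  (a + b) C b            ≡⟨ cong (_C b) (ℕP.+-comm a b) ⟩
  (b + a) C b            ∎)
  where open ≡-Reasoning

tradeProb-sym : ∀ {n m} (A : Mat n m) i j K → tradeProb A i j K ≡ tradeProb A j i K
tradeProb-sym {n} {m} A i j K =
  cong₂ frac same-count (sym (choose-swap (sDiff A i j) (sDiff A j i)))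
  where
  tradesTo : Fin n → Fin n → Vec Bool m → Bool
  tradesTo a b T = admissible A a b T ∧ eqMat (trade A a b T) K
  same-count : countB (tradesTo i j) (allVec m) ≡ countB (tradesTo j i) (allVec m)
  same-count = trans
    (countB-cong (λ T → sym (cong₂ _∧_ (admissible-mirror A i j T) (cong (λ X → eqMat X K) (trade-mirror A i j T))))
                 (allVec m))
    (sym (countB-reindex (tradesTo j i) (mirror A i j) (mirror A i j) (mirror-involutive A i j)
                         (mirror-involutive A i j) (allVec-unique m) allVec-complete))

permuteVec : ∀ {m} → Permutation′ m → Vec Bool m → Vec Bool m
permuteVec π T = Vec.tabulate (λ l → lookup T (π ⟨$⟩ʳ l))

lookup-permuteVec : ∀ {m} (π : Permutation′ m) T l → lookup (permuteVec π T) l ≡ lookup T (π ⟨$⟩ʳ l)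
lookup-permuteVec π T l = VecP.lookup∘tabulate (λ l → lookup T (π ⟨$⟩ʳ l)) l

permuteVec-flipʳ : ∀ {m} (π : Permutation′ m) T → permuteVec π (permuteVec (flip π) T) ≡ T
permuteVec-flipʳ π T = trans (VecP.tabulate-cong (λ l → trans (lookup-permuteVec (flip π) T _)
                                                               (cong (lookup T) (inverseˡ π))))
                             (VecP.tabulate∘lookup T)

permuteVec-flipˡ : ∀ {m} (π : Permutation′ m) T → permuteVec (flip π) (permuteVec π T) ≡ T
permuteVec-flipˡ π T = trans (VecP.tabulate-cong (λ l → trans (lookup-permuteVec π T _)
                                                               (cong (lookup T) (inverseʳ π))))
                             (VecP.tabulate∘lookup T)

-- Every ingredient of a trade commutes with relabelling; a choice U for the
-- rows (π₁ i , π₁ j) of A corresponds to the choice permuteVec π₂ U for the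
-- rows (i , j) of relabel π₁ π₂ A.
module _ {n m} (π₁ : Permutation′ n) (π₂ : Permutation′ m) (A : Mat n m) where

  private
    p₁ : Fin n → Fin n
    p₁ = π₁ ⟨$⟩ʳ_
    p₂ : Fin m → Fin m
    p₂ = π₂ ⟨$⟩ʳ_
    A′ : Mat n m
    A′ = relabel π₁ π₂ A

  inSym-relabel : ∀ i j l → inSym A′ i j l ≡ inSym A (p₁ i) (p₁ j) (p₂ l)
  inSym-relabel i j l = cong₂ _xor_ (entry-relabel π₁ π₂ A i l) (entry-relabel π₁ π₂ A j l)

  sDiff-relabel : ∀ i j → sDiff A′ i j ≡ sDiff A (p₁ i) (p₁ j)
  sDiff-relabel i j = trans
    (countB-cong (λ l → cong₂ (λ u v → u ∧ not v) (entry-relabel π₁ π₂ A i l) (entry-relabel π₁ π₂ A j l)) (fins m))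
    (sym (countB-fins-perm π₂ (λ l → entry A (p₁ i) l ∧ not (entry A (p₁ j) l))))

  admissible-relabel : ∀ i j U → admissible A′ i j (permuteVec π₂ U) ≡ admissible A (p₁ i) (p₁ j) U
  admissible-relabel i j U = cong₂ _∧_ (cong (_≡ᵇ 0) same-outside) (cong₂ _≡ᵇ_ same-size (sDiff-relabel i j))
    where
    same-outside : outsideCount A′ i j (permuteVec π₂ U) ≡ outsideCount A (p₁ i) (p₁ j) U
    same-outside = trans
      (countB-cong (λ l → cong₂ (λ u v → u ∧ not v) (lookup-permuteVec π₂ U l) (inSym-relabel i j l)) (fins m))
      (sym (countB-fins-perm π₂ (λ l → lookup U l ∧ not (inSym A (p₁ i) (p₁ j) l))))
    same-size : chosenCount (permuteVec π₂ U) ≡ chosenCount U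
    same-size = trans (countB-cong (lookup-permuteVec π₂ U) (fins m)) (sym (countB-fins-perm π₂ (lookup U)))

  trade-relabel : ∀ i j U → trade A′ i j (permuteVec π₂ U) ≡ relabel π₁ π₂ (trade A (p₁ i) (p₁ j) U)
  trade-relabel i j U = matrix-ext λ a b → begin
    entry (trade A′ i j (permuteVec π₂ U)) a b
      ≡⟨ entry-trade A′ i j (permuteVec π₂ U) a b ⟩
    (if sameFin a j then (if inSym A′ i j b then not (lookup (permuteVec π₂ U) b) else entry A′ j b)
     else if sameFin a i then (if inSym A′ i j b then lookup (permuteVec π₂ U) b else entry A′ i b)
     else entry A′ a b)
      ≡⟨ relabelled-entry a b ⟩
    entry (trade A (p₁ i) (p₁ j) U) (p₁ a) (p₂ b)
      ≡⟨ entry-relabel π₁ π₂ (trade A (p₁ i) (p₁ j) U) a b ⟨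
    entry (relabel π₁ π₂ (trade A (p₁ i) (p₁ j) U)) a b ∎
    where
    open ≡-Reasoning
    relabelled-entry : ∀ a b →
      (if sameFin a j then (if inSym A′ i j b then not (lookup (permuteVec π₂ U) b) else entry A′ j b)
       else if sameFin a i then (if inSym A′ i j b then lookup (permuteVec π₂ U) b else entry A′ i b)
       else entry A′ a b)
      ≡ entry (trade A (p₁ i) (p₁ j) U) (p₁ a) (p₂ b)
    relabelled-entry a b
      rewrite entry-trade A (p₁ i) (p₁ j) U (p₁ a) (p₂ b)
            | inSym-relabel i j b | lookup-permuteVec π₂ U b
            | entry-relabel π₁ π₂ A j b | entry-relabel π₁ π₂ A i b | entry-relabel π₁ π₂ A a b
            | sameFin-perm π₁ a j | sameFin-perm π₁ a i = refl

  tradeProb-relabel : ∀ i j K → tradeProb A′ i j (relabel π₁ π₂ K) ≡ tradeProb A (p₁ i) (p₁ j) K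
  tradeProb-relabel i j K = cong₂ frac same-count
    (cong₂ (λ a b → (a + b) C a) (sDiff-relabel i j) (sDiff-relabel j i))
    where
    tradesTo : Mat n m → Fin n → Fin n → Mat n m → Vec Bool m → Bool
    tradesTo X a b Y T = admissible X a b T ∧ eqMat (trade X a b T) Y
    same-count : countB (tradesTo A′ i j (relabel π₁ π₂ K)) (allVec m) ≡ countB (tradesTo A (p₁ i) (p₁ j) K) (allVec m)
    same-count = trans
      (countB-reindex _ (permuteVec π₂) (permuteVec (flip π₂)) (permuteVec-flipʳ π₂) (permuteVec-flipˡ π₂)
                      (allVec-unique m) allVec-complete)
      (countB-cong (λ U → cong₂ _∧_ (admissible-relabel i j U)
                     (trans (cong (λ X → eqMat X (relabel π₁ π₂ K)) (trade-relabel i j U))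
                            (eqMat-injective (relabel π₁ π₂) (relabel-injective π₁ π₂) _ K)))
                   (allVec m))

-- P^C with the with-abstraction of its definition (on n choose 2) made explicit.
curveballProb : ∀ {n m} → ℕ → Mat n m → Mat n m → ℚ
curveballProb zero        G K = indicator (eqMat G K)
curveballProb {n} (suc d) G K =
  frac 1 (suc d) * sumℚ (map (λ p → tradeProb G (proj₁ p) (proj₂ p) K) (pairsOf (fins n)))

PC-unfold : ∀ {n m} (G K : Mat n m) → PC G K ≡ curveballProb (n C 2) G K
PC-unfold {n} G K with n C 2
... | zero  = refl
... | suc d = cong (λ ps → frac 1 (suc d) * sumℚ ps) (ListP.map-cong (λ { (i , j) → refl }) (pairsOf (fins n)))

-- The Curveball chain is invariant under relabelling of the nodes: the row
-- pair {i , j} of the relabelled matrix plays the role of {π₁ i , π₁ j}, and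
-- the sum over all unordered row pairs is reindexed along π₁.
PC-relabel : ∀ {n m} π₁ π₂ (A K : Mat n m) → PC (relabel π₁ π₂ A) (relabel π₁ π₂ K) ≡ PC A K
PC-relabel {n} {m} π₁ π₂ A K = begin
  PC A′ K′                       ≡⟨ PC-unfold A′ K′ ⟩
  curveballProb (n C 2) A′ K′    ≡⟨ same-prob (n C 2) ⟩
  curveballProb (n C 2) A K      ≡⟨ PC-unfold A K ⟨
  PC A K                         ∎
  where
  open ≡-Reasoning
  A′ K′ : Mat n m
  A′ = relabel π₁ π₂ A
  K′ = relabel π₁ π₂ K
  p₁ : Fin n → Fin n
  p₁ = π₁ ⟨$⟩ʳ_
  h : Fin n × Fin n → ℚ
  h p = tradeProb A (proj₁ p) (proj₂ p) K
  relabelPair : Fin n × Fin n → Fin n × Fin n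
  relabelPair p = (p₁ (proj₁ p) , p₁ (proj₂ p))
  same-sum : sumℚ (map (λ p → tradeProb A′ (proj₁ p) (proj₂ p) K′) (pairsOf (fins n))) ≡ sumℚ (map h (pairsOf (fins n)))
  same-sum = begin
    sumℚ (map (λ p → tradeProb A′ (proj₁ p) (proj₂ p) K′) (pairsOf (fins n)))
      ≡⟨ cong sumℚ (ListP.map-cong (λ p → tradeProb-relabel π₁ π₂ A (proj₁ p) (proj₂ p) K) (pairsOf (fins n))) ⟩
    sumℚ (map (λ p → h (relabelPair p)) (pairsOf (fins n)))
      ≡⟨ cong sumℚ (ListP.map-∘ (pairsOf (fins n))) ⟩
    sumℚ (map h (map relabelPair (pairsOf (fins n))))
      ≡⟨ cong (λ ps → sumℚ (map h ps)) (pairsOf-map p₁ (fins n)) ⟨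
    sumℚ (map h (pairsOf (map p₁ (fins n))))
      ≡⟨ ℚSum.pairTotal-↭ h (λ x y → tradeProb-sym A x y K)
           (map-bijection-↭ p₁ (π₁ ⟨$⟩ˡ_) (λ _ → inverseʳ π₁) (λ _ → inverseˡ π₁) (fins-unique n) fins-complete) ⟩
    sumℚ (map h (pairsOf (fins n))) ∎
  same-prob : ∀ d → curveballProb d A′ K′ ≡ curveballProb d A K
  same-prob zero    = cong indicator (eqMat-injective (relabel π₁ π₂) (relabel-injective π₁ π₂) A K)
  same-prob (suc d) = cong (frac 1 (suc d) *_) same-sum

rowSum-relabel : ∀ {n m} π₁ π₂ (K : Mat n m) a → rowSum (relabel π₁ π₂ K) a ≡ rowSum K (π₁ ⟨$⟩ʳ a)
rowSum-relabel {n} {m} π₁ π₂ K a = begin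
  rowSum (relabel π₁ π₂ K) a                                ≡⟨ rowSum-count (relabel π₁ π₂ K) a ⟩
  countB (entry (relabel π₁ π₂ K) a) (fins m)               ≡⟨ countB-cong (entry-relabel π₁ π₂ K a) (fins m) ⟩
  countB (λ b → entry K (π₁ ⟨$⟩ʳ a) (π₂ ⟨$⟩ʳ b)) (fins m)   ≡⟨ countB-fins-perm π₂ (entry K (π₁ ⟨$⟩ʳ a)) ⟨
  countB (entry K (π₁ ⟨$⟩ʳ a)) (fins m)                     ≡⟨ rowSum-count K (π₁ ⟨$⟩ʳ a) ⟨
  rowSum K (π₁ ⟨$⟩ʳ a)                                      ∎
  where
  open ≡-Reasoning
  rowSum-count : ∀ (X : Mat n m) i → rowSum X i ≡ countB (entry X i) (fins m)
  rowSum-count X i = trans (cong (countB (λ b → b)) (sym (trans (sym (VecP.toList-map (lookup (lookup X i)) (allFin m)))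
                                                               (cong toList (VecP.map-lookup-allFin (lookup X i))))))
                           (countB-map (λ b → b) (lookup (lookup X i)) (fins m))

colSum-relabel : ∀ {n m} π₁ π₂ (K : Mat n m) b → colSum (relabel π₁ π₂ K) b ≡ colSum K (π₂ ⟨$⟩ʳ b)
colSum-relabel {n} π₁ π₂ K b = trans (countB-cong (λ i → entry-relabel π₁ π₂ K i b) (fins n))
                                     (sym (countB-fins-perm π₁ (λ i → entry K i (π₂ ⟨$⟩ʳ b))))

record PreservesDegrees {n m} (r : Vec ℕ n) (c : Vec ℕ m) (π₁ : Permutation′ n) (π₂ : Permutation′ m) : Set where
  constructor _,_
  field
    rows : ∀ a → lookup r (π₁ ⟨$⟩ʳ a) ≡ lookup r a
    cols : ∀ b → lookup c (π₂ ⟨$⟩ʳ b) ≡ lookup c b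

relabel-preservesDegrees : ∀ {n m} {r : Vec ℕ n} {c : Vec ℕ m} π₁ π₂ (K : Mat n m) →
  InΩ r c K → InΩ r c (relabel π₁ π₂ K) → PreservesDegrees r c π₁ π₂
relabel-preservesDegrees π₁ π₂ K (rowsK , colsK) (rowsK′ , colsK′) =
  (λ a → trans (sym (rowsK (π₁ ⟨$⟩ʳ a))) (trans (sym (rowSum-relabel π₁ π₂ K a)) (rowsK′ a))) ,
  (λ b → trans (sym (colsK (π₂ ⟨$⟩ʳ b))) (trans (sym (colSum-relabel π₁ π₂ K b)) (colsK′ b)))

preservesDegrees-flip : ∀ {n m} {r : Vec ℕ n} {c : Vec ℕ m} {π₁ π₂} →
  PreservesDegrees r c π₁ π₂ → PreservesDegrees r c (flip π₁) (flip π₂)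
preservesDegrees-flip {r = r} {c} {π₁} {π₂} (rows , cols) =
  (λ a → trans (sym (rows (π₁ ⟨$⟩ˡ a))) (cong (lookup r) (inverseʳ π₁))) ,
  (λ b → trans (sym (cols (π₂ ⟨$⟩ˡ b))) (cong (lookup c) (inverseʳ π₂)))

relabel-InΩ : ∀ {n m} {r : Vec ℕ n} {c : Vec ℕ m} {π₁ π₂} (K : Mat n m) →
  PreservesDegrees r c π₁ π₂ → InΩ r c K → InΩ r c (relabel π₁ π₂ K)
relabel-InΩ {π₁ = π₁} {π₂} K (rows , cols) (rowsK , colsK) =
  (λ a → trans (rowSum-relabel π₁ π₂ K a) (trans (rowsK _) (rows a))) ,
  (λ b → trans (colSum-relabel π₁ π₂ K b) (trans (colsK _) (cols b)))

relabel-∼ : ∀ {n m} π₁ π₂ {K H : Mat n m} → K ∼ H → relabel π₁ π₂ K ∼ H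
relabel-∼ π₁ π₂ {K} (τ₁ , τ₂ , K≅H) = π₁ ∘ₚ τ₁ , π₂ ∘ₚ τ₂ , λ a b → trans (entry-relabel π₁ π₂ K a b) (K≅H _ _)

∼⇒relabel : ∀ {n m} {G G′ : Mat n m} (G∼G′ : G ∼ G′) → G ≡ relabel (proj₁ G∼G′) (proj₁ (proj₂ G∼G′)) G′
∼⇒relabel {G′ = G′} (σ₁ , σ₂ , G≅G′) = matrix-ext λ a b → trans (G≅G′ a b) (sym (entry-relabel σ₁ σ₂ G′ a b))

class-relabel-↭ : ∀ {n m} {r : Vec ℕ n} {c : Vec ℕ m} {H : Mat n m} π₁ π₂ (L : List (Mat n m)) → Unique L →
  (∀ K → (K ∈ L) ⇔ (InΩ r c K × K ∼ H)) → PreservesDegrees r c π₁ π₂ → map (relabel π₁ π₂) L ↭ L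
class-relabel-↭ {r = r} {c} {H} π₁ π₂ L unique enumerates preserves =
  unique-sameElems-↭ (UniqueP.map⁺ (relabel-injective π₁ π₂) unique) unique to from
  where
  stable : ∀ {ρ₁ ρ₂} → PreservesDegrees r c ρ₁ ρ₂ → ∀ K → K ∈ L → relabel ρ₁ ρ₂ K ∈ L
  stable {ρ₁} {ρ₂} ρ-preserves K K∈L with Equivalence.to (enumerates K) K∈L
  ... | K∈Ω , K∼H = Equivalence.from (enumerates (relabel ρ₁ ρ₂ K))
                      (relabel-InΩ K ρ-preserves K∈Ω , relabel-∼ ρ₁ ρ₂ {K} {H} K∼H)
  to : ∀ K → K ∈ map (relabel π₁ π₂) L → K ∈ L
  to K K∈ with ∈-map⁻ (relabel π₁ π₂) K∈
  ... | K₀ , K₀∈L , refl = stable preserves K₀ K₀∈L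
  from : ∀ K → K ∈ L → K ∈ map (relabel π₁ π₂) L
  from K K∈L = subst (_∈ map (relabel π₁ π₂) L) (relabel-relabel-flip π₁ π₂ K)
    (∈-map⁺ (relabel π₁ π₂) (stable (preservesDegrees-flip preserves) K K∈L))

invariant-kernel-sum : ∀ {n m} π₁ π₂ (P : Mat n m → Mat n m → ℚ) →
  (∀ A K → P (relabel π₁ π₂ A) (relabel π₁ π₂ K) ≡ P A K) →
  ∀ {L} → map (relabel π₁ π₂) L ↭ L → ∀ G → sumℚ (map (P (relabel π₁ π₂ G)) L) ≡ sumℚ (map (P G) L)
invariant-kernel-sum π₁ π₂ P invariant {L} L↭ G = begin
  sumℚ (map (P (relabel π₁ π₂ G)) L)                       ≡⟨ ℚSum.total-map-↭ (P (relabel π₁ π₂ G)) L↭ ⟨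
  sumℚ (map (P (relabel π₁ π₂ G)) (map (relabel π₁ π₂) L)) ≡⟨ cong sumℚ (ListP.map-∘ L) ⟨
  sumℚ (map (λ K → P (relabel π₁ π₂ G) (relabel π₁ π₂ K)) L) ≡⟨ cong sumℚ (ListP.map-cong (invariant G) L) ⟩
  sumℚ (map (P G) L)                                       ∎
  where open ≡-Reasoning

lemma4p1 : ∀ {n m} (r : Vec ℕ n) (c : Vec ℕ m) (H G G′ : Mat n m) →
    InΩ r c H → InΩ r c G → InΩ r c G′ → G ∼ G′ →
    (L : List (Mat n m)) → Unique L → (∀ K → (K ∈ L) ⇔ (InΩ r c K × K ∼ H)) →
    (sumℚ (map (PS G) L) ≡ sumℚ (map (PS G′) L))
    × (sumℚ (map (PC G) L) ≡ sumℚ (map (PC G′) L))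
lemma4p1 {n} {m} r c H G G′ _ G∈Ω G′∈Ω G∼G′@(σ₁ , σ₂ , _) L unique enumerates =
  lumped PS (PS-relabel σ₁ σ₂) , lumped PC (PC-relabel σ₁ σ₂)
  where
  G≡ : G ≡ relabel σ₁ σ₂ G′
  G≡ = ∼⇒relabel {G = G} {G′} G∼G′
  σ-preserves : PreservesDegrees r c σ₁ σ₂
  σ-preserves = relabel-preservesDegrees σ₁ σ₂ G′ G′∈Ω (subst (InΩ r c) G≡ G∈Ω)
  lumped : (P : Mat n m → Mat n m → ℚ) → (∀ A K → P (relabel σ₁ σ₂ A) (relabel σ₁ σ₂ K) ≡ P A K) →
           sumℚ (map (P G) L) ≡ sumℚ (map (P G′) L)
  lumped P invariant = trans (cong (λ X → sumℚ (map (P X) L)) G≡)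
    (invariant-kernel-sum σ₁ σ₂ P invariant (class-relabel-↭ {H = H} σ₁ σ₂ L unique enumerates σ-preserves) G′)
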